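{- Let $\mathcal{L}_1$ and $\mathcal{L}_2$ be LTSs. For all states $(U,s),(V,s)$ of $\mathsf{norm}_{\mathsf{fdr}}(\mathcal{L}_1)\ltimes\mathcal{L}_2$ satisfying $(U,s)\leq(V,s)$: if $(V,s)$ is an FD-witness then $(U,s)$ is an FD-witness.
   Context: Fix a finite set $\mathit{Act}$ of actions not containing the internal action $\tau$; $\mathit{Act}_\tau=\mathit{Act}\cup\{\tau\}$. An LTS is $(S,\iota,\rightarrow)$ with $\iota\in S$ and $\rightarrow\subseteq S\times\mathit{Act}_\tau\times S$; $\mathsf{enabled}(s)=\{a\in\mathit{Act}_\tau\mid\exists t: s\xrightarrow{a}t\}$. The weak transition $s\overset{a}{\Longrightarrow}t$ ($a\in\mathit{Act}$) holds iff there is a path from $s$ to $t$ consisting of $\tau$-transitions, one $a$-transition, and $\tau$-transitions; $s\overset{\epsilon}{\Longrightarrow}t$ iff $t$ is reachable from $s$ by $\tau$-transitions only. A state $s$ is stable if $\tau\notin\mathsf{enabled}(s)$; for stable $s$, $\mathsf{refusals}(s)=\mathcal{P}(\mathit{Act}\setminus\mathsf{enabled}(s))$; for a set $U$, $\mathsf{refusals}(U)=\{X\subseteq\mathit{Act}\mid\exists s\in U: s\text{ stable}\wedge X\in\mathsf{refusals}(s)\}$. A state diverges if there is an infinite sequence of $\tau$-transitions from it; a set diverges if one of its states does. For $\mathcal{L}_1=(S_1,\iota_1,\rightarrow_1)$, $\mathsf{norm}_{\mathsf{fdr}}(\mathcal{L}_1)$ has states $\mathcal{P}(S_1)$, initial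 state $\{s\mid\iota_1\overset{\epsilon}{\Longrightarrow}s\}$, and for $U,V\subseteq S_1$, $a\in\mathit{Act}$: $U\xrightarrow{a}V$ iff $U$ does not diverge and $V=\{t\mid\exists s\in U: s\overset{a}{\Longrightarrow}t\}$. For $\mathcal{L}_2=(S_2,\iota_2,\rightarrow_2)$, the product $\mathcal{M}\ltimes\mathcal{L}_2$ of $\mathcal{M}=(T,\iota_T,\rightarrow_T)$ and $\mathcal{L}_2$ has states $T\times S_2$, initial state $(\iota_T,\iota_2)$, and the smallest transition relation with $(u,s)\xrightarrow{\tau}(u,t)$ if $s\xrightarrow{\tau}_2t$, and $(u,s)\xrightarrow{a}(u',t)$ if $u\xrightarrow{a}_Tu'$ and $s\xrightarrow{a}_2t$ for $a\in\mathit{Act}$. States of $\mathsf{norm}_{\mathsf{fdr}}(\mathcal{L}_1)\ltimes\mathcal{L}_2$ are ordered by $(U,s)\leq(V,t)$ iff $s=t$ and $U\subseteq V$. A state $(U,s)$ of this product is an FD-witness iff $U$ does not diverge and at least one holds: $U=\emptyset$; or $s$ is stable and $\mathsf{refusals}(s)\not\subseteq\mathsf{refusals}(U)$; or $s$ diverges. -}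

module Defs where

open import Level using (Level; _⊔_; suc; 0ℓ)
open import Data.Nat using (ℕ) renaming (suc to sucℕ)
open import Data.Fin using (Fin)
open import Data.Fin.Subset using (Subset; _∈_; _∉_)
open import Data.Product using (Σ; ∃; _×_; _,_)
open import Data.Sum using (_⊎_)
open import Relation.Nullary using (¬_)
open import Relation.Unary using (Pred; _⊆_)
open import Relation.Binary.PropositionalEquality using (_≡_)
open import Relation.Binary.Construct.Closure.ReflexiveTransitive using (Star)

data Actτ (n : ℕ) : Set where
  τ   : Actτ n
  act : Fin n → Actτ n

record LTS (n : ℕ) (ℓ : Level) : Set (suc ℓ) where
  field
    State : Set ℓ
    init  : State
    _⟶[_]_ : State → Actτ n → State → Set ℓ
open LTS public

module _ {n : ℕ} {ℓ : Level} (L : LTS n ℓ) where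

  Enabled : State L → Actτ n → Set ℓ
  Enabled s a = ∃ λ t → _⟶[_]_ L s a t

  τStep : State L → State L → Set ℓ
  τStep s t = _⟶[_]_ L s τ t

  WeakEps : State L → State L → Set ℓ
  WeakEps = Star τStep

  Weak : State L → Fin n → State L → Set ℓ
  Weak s a t = ∃ λ s' → ∃ λ t' → WeakEps s s' × _⟶[_]_ L s' (act a) t' × WeakEps t' t

  Stable : State L → Set ℓ
  Stable s = ¬ Enabled s τ

  -- X ∈ refusals(s)  (only meaningful for stable s): X ⊆ Act ∖ enabled(s)
  InRefusals : State L → Subset n → Set ℓ
  InRefusals s X = ∀ a → a ∈ X → ¬ Enabled s (act a)

  InRefusalsSet : Pred (State L) ℓ → Subset n → Set ℓ
  InRefusalsSet U X = ∃ λ s → U s × Stable s × InRefusals s X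

  Diverges : State L → Set ℓ
  Diverges s = Σ (ℕ → State L) λ f → f 0 ≡ s × (∀ i → τStep (f i) (f (sucℕ i)))

  DivergesSet : Pred (State L) ℓ → Set ℓ
  DivergesSet U = ∃ λ s → U s × Diverges s

  _≐_ : Pred (State L) ℓ → Pred (State L) ℓ → Set ℓ
  U ≐ V = (U ⊆ V) × (V ⊆ U)

  normFdr : LTS n (suc ℓ)
  normFdr = record
    { State = Pred (State L) ℓ
    ; init  = λ s → WeakEps (init L) s
    ; _⟶[_]_ = step
    }
    where
      step : Pred (State L) ℓ → Actτ n → Pred (State L) ℓ → Set (suc ℓ)
      step U τ V = Level.Lift _ Data.Empty.⊥
        where import Data.Empty
      step U (act a) V = Level.Lift (suc ℓ)
        ((¬ DivergesSet U) × (V ≐ (λ t → ∃ λ s → U s × Weak s a t)))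

data ProdStep {n : ℕ} {ℓ₁ ℓ₂ : Level} (M : LTS n ℓ₁) (L : LTS n ℓ₂)
  : State M × State L → Actτ n → State M × State L → Set (ℓ₁ ⊔ ℓ₂) where
  tau : ∀ {u s t} → _⟶[_]_ L s τ t → ProdStep M L (u , s) τ (u , t)
  vis : ∀ {u u' s t} {a : Fin n} → _⟶[_]_ M u (act a) u' → _⟶[_]_ L s (act a) t
      → ProdStep M L (u , s) (act a) (u' , t)

_⋉_ : {n : ℕ} {ℓ₁ ℓ₂ : Level} → LTS n ℓ₁ → LTS n ℓ₂ → LTS n (ℓ₁ ⊔ ℓ₂)
M ⋉ L = record { State = State M × State L ; init = (init M , init L) ; _⟶[_]_ = ProdStep M L }

module _ {n : ℕ} {ℓ₁ ℓ₂ : Level} (L₁ : LTS n ℓ₁) (L₂ : LTS n ℓ₂) where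

  _≤ₚ_ : State (normFdr L₁ ⋉ L₂) → State (normFdr L₁ ⋉ L₂) → Set (ℓ₁ ⊔ ℓ₂)
  (U , s) ≤ₚ (V , t) = (s ≡ t) × (U ⊆ V)

  FDWitness : State (normFdr L₁ ⋉ L₂) → Set (ℓ₁ ⊔ ℓ₂)
  FDWitness (U , s) =
    (¬ DivergesSet L₁ U) ×
    ( (∀ x → ¬ U x)
    ⊎ (Stable L₂ s × ∃ λ (X : Subset n) → InRefusals L₂ s X × ¬ InRefusalsSet L₁ U X)
    ⊎ Diverges L₂ s )

-- Being an FD-witness is a condition on a product state (U , s) in which the
-- set U of specification states occurs only negatively: U must not diverge,
-- and in the first two disjuncts U must be empty, resp. must fail to offer
-- some refusal of s.  Each of these three conditions is antitone in U, i.e.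
-- preserved when U is replaced by a subset.  The third disjunct (s diverges)
-- does not mention U at all.  Hence shrinking U while keeping s fixed, which
-- is exactly the order ≤ₚ on states of norm_fdr(L₁) ⋉ L₂, preserves
-- FD-witnesses.
module Submission where

open import Defs
open import Level using (Level)
open import Data.Nat using (ℕ)
open import Data.Fin.Subset using (Subset)
open import Data.Product using (∃; _×_; _,_)
open import Data.Sum using (_⊎_; inj₁; inj₂)
open import Relation.Nullary using (¬_)
open import Relation.Unary using (Pred; _⊆_)

module _ {n : ℕ} {ℓ : Level} (L : LTS n ℓ) {U V : Pred (State L) ℓ} (U⊆V : U ⊆ V) where

  nonDivergent-antitone : ¬ DivergesSet L V → ¬ DivergesSet L U
  nonDivergent-antitone ¬divV (x , x∈U , div) = ¬divV (x , U⊆V x∈U , div)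

  empty-antitone : (∀ x → ¬ V x) → (∀ x → ¬ U x)
  empty-antitone V-empty x x∈U = V-empty x (U⊆V x∈U)

  nonRefusal-antitone : (X : Subset n) → ¬ InRefusalsSet L V X → ¬ InRefusalsSet L U X
  nonRefusal-antitone X ¬refV (x , x∈U , stable , refuses) =
    ¬refV (x , U⊆V x∈U , stable , refuses)

witnessReason-antitone : {n : ℕ} {ℓ₁ ℓ₂ : Level} (L₁ : LTS n ℓ₁) (L₂ : LTS n ℓ₂)
    → {U V : State (normFdr L₁)} (s : State L₂) → U ⊆ V
    → (∀ x → ¬ V x)
      ⊎ (Stable L₂ s × ∃ λ (X : Subset n) → InRefusals L₂ s X × ¬ InRefusalsSet L₁ V X)
      ⊎ Diverges L₂ s
    → (∀ x → ¬ U x)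
      ⊎ (Stable L₂ s × ∃ λ (X : Subset n) → InRefusals L₂ s X × ¬ InRefusalsSet L₁ U X)
      ⊎ Diverges L₂ s
witnessReason-antitone L₁ L₂ s U⊆V (inj₁ V-empty) =
  inj₁ (empty-antitone L₁ U⊆V V-empty)
witnessReason-antitone L₁ L₂ s U⊆V (inj₂ (inj₁ (stable , X , refusedByS , ¬refV))) =
  inj₂ (inj₁ (stable , X , refusedByS , nonRefusal-antitone L₁ U⊆V X ¬refV))
witnessReason-antitone L₁ L₂ s U⊆V (inj₂ (inj₂ sDiverges)) =
  inj₂ (inj₂ sDiverges)

lemma5p9 : {n : ℕ} {ℓ₁ ℓ₂ : Level} (L₁ : LTS n ℓ₁) (L₂ : LTS n ℓ₂)
    → (U V : State (normFdr L₁)) (s : State L₂)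
    → _≤ₚ_ L₁ L₂ (U , s) (V , s)
    → FDWitness L₁ L₂ (V , s)
    → FDWitness L₁ L₂ (U , s)
lemma5p9 L₁ L₂ U V s (_ , U⊆V) (¬divV , reason) =
  nonDivergent-antitone L₁ U⊆V ¬divV , witnessReason-antitone L₁ L₂ s U⊆V reason
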